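{- Let $p$ be an odd prime and $q=p^r$ with $q\equiv1\pmod4$. Suppose $a,b,c,d,e,f\in\mathbb{F}_q^\times$ satisfy $af=ce$, $c^2=4ab$ and $ab=de$. Let $\#C_{a,b,c,d,e,f}(\mathbb{F}_q)$ be the number of $(x,y)\in\mathbb{F}_q^2$ with $ay^2+bx^2+cxy=d+ex^2y^2+fx^3y$. Then $$\#C_{a,b,c,d,e,f}(\mathbb{F}_q)=\begin{cases}2q-3+(q-2)\varphi(ad), & \text{if } q\equiv1\pmod8,\\ 2q-1+q\varphi(ad), & \text{if } q\equiv 5\pmod 8.\end{cases}$$
   Context: $\varphi$ denotes the quadratic character of $\mathbb{F}_q^\times$ (value $1$ on nonzero squares, $-1$ on non-squares). -}

module Defs where

open import Level using (0ℓ)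
open import Data.Nat as ℕ using (ℕ; zero; suc)
open import Data.Integer as ℤ using (ℤ)
open import Data.Bool using (if_then_else_)
open import Data.Product using (_×_; _,_; ∃; proj₁; proj₂)
open import Data.List using (List; length; filter; cartesianProduct)
open import Data.List.Membership.Propositional using (_∈_)
open import Data.List.Relation.Unary.Unique.Propositional using (Unique)
open import Data.List.Relation.Unary.Any using (any?)
open import Relation.Nullary using (¬_; Dec; does; yes; no)
open import Relation.Binary.PropositionalEquality using (_≡_)
open import Algebra.Structures using (IsCommutativeRing)

record FiniteField : Set₁ where
  infixl 6 _+_
  infixl 7 _*_
  field
    Carrier  : Set
    _+_ _*_  : Carrier → Carrier → Carrier
    -_       : Carrier → Carrier
    0# 1#    : Carrier
    isCommutativeRing : IsCommutativeRing _≡_ _+_ _*_ -_ 0# 1#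
    0≢1      : ¬ (0# ≡ 1#)
    inverse  : ∀ x → ¬ (x ≡ 0#) → ∃ λ y → x * y ≡ 1#
    _≟_      : (x y : Carrier) → Dec (x ≡ y)
    elements : List Carrier
    complete : ∀ x → x ∈ elements
    unique   : Unique elements

  card : ℕ
  card = length elements

  fromℕ : ℕ → Carrier
  fromℕ zero    = 0#
  fromℕ (suc n) = 1# + fromℕ n

  φ : Carrier → ℤ
  φ x with x ≟ 0#
  ... | yes _ = ℤ.0ℤ
  ... | no  _ = if does (any? (λ y → (y * y) ≟ x) elements) then ℤ.1ℤ else ℤ.-1ℤ

  curveCount : (a b c d e f : Carrier) → ℕ
  curveCount a b c d e f =
    length (filter (λ (xy : Carrier × Carrier) → let x = proj₁ xy ; y = proj₂ xy in
                      (a * (y * y) + b * (x * x) + c * (x * y)) ≟ (d + e * ((x * x) * (y * y)) + f * ((x * x * x) * y)))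
                   (cartesianProduct elements elements))

module Submission where

-- With h = c/2 the hypotheses say h² = ab = de and af = ce, and then
--   a² (a y² + b x² + c x y - d - e x² y² - f x³ y) = (a - e x²) ((a y + h x)² - d (a + e x²)).
-- Hence the fibre of the curve over x has q points if e x² = a (where d (a + e x²) = 2 a d), and
-- otherwise as many points as d (a + e x²) = a d + h² x² has square roots, i.e. 1 + φ(a d + h² x²).
-- The substitution w = v + h x turns w² = a d + h² x² into the hyperbola v (v + 2 h x) = a d, which has
-- q - 1 points, and e x² = a has 1 + φ(a/e) = 1 + φ(a d) solutions, so
--   #C = (q - 1) + (1 + φ(a d)) (q - 1 - φ(2)).
-- Finally φ(2) = 1 for q ≡ 1 (mod 8) and φ(2) = -1 for q ≡ 5 (mod 8): pairing the nonzero squares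
-- (resp. fourth powers) with their inverses, whose only fixed points are ±1, shows that -1 is a square
-- and that -1 is a fourth power exactly when (q - 1)/4 is even; and 2 is a square exactly when -1 is a
-- fourth power, because (1 + i)² = 2 i for i² = -1.

open import Defs
open import Data.Nat as ℕ using (ℕ; _^_; _%_)
open import Data.Nat.Primality using (Prime)
open import Data.Integer as ℤ using (ℤ; +_)
open import Data.Product using (_×_)
open import Relation.Nullary using (¬_)
open import Relation.Binary.PropositionalEquality using (_≡_)

open import Level using (0ℓ)
open import Data.Nat using (zero; suc; _/_)
import Data.Nat.Properties as ℕ
import Data.Nat.DivMod as ℕ
open import Data.Nat.ListAction using (sum)
open import Data.Nat.ListAction.Properties using (sum-↭; sum-++)
open import Data.Integer using (0ℤ; 1ℤ; -1ℤ; -[1+_])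
import Data.Integer.Properties as ℤ
open import Data.Integer.Tactic.RingSolver using (solve-∀)
open import Data.Sign as Sign using (Sign)
open import Data.Fin as Fin using (Fin)
import Data.Fin.Properties as Fin
open import Data.Unit using (⊤; tt)
open import Data.Maybe using (Maybe; just; nothing)
open import Data.Product using (_,_; proj₁; proj₂; ∃)
open import Data.Sum as Sum using (_⊎_; inj₁; inj₂; [_,_]′)
open import Data.List using (List; []; _∷_; _++_; map; filter; length; lookup; cartesianProduct)
open import Data.List.Properties using (map-cong; map-∘; map-++)
open import Data.List.Membership.Propositional using (_∈_; lose)
open import Data.List.Membership.Propositional.Properties using (∈-filter⁺; ∈-filter⁻; ∈-map⁺)
open import Data.List.Membership.Propositional.Properties.WithK using (unique∧set⇒bag)
open import Data.List.Relation.Unary.All using ([]; _∷_)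
open import Data.List.Relation.Unary.Any as Any using (here; there; any?; satisfied)
open import Data.List.Relation.Unary.Any.Properties using (lookup-index)
open import Data.List.Relation.Unary.Unique.Propositional using (Unique; []; _∷_)
import Data.List.Relation.Unary.Unique.Propositional.Properties as Unique
open import Data.List.Relation.Binary.Permutation.Propositional using (_↭_)
import Data.List.Relation.Binary.Permutation.Propositional.Properties as ↭
open import Data.List.Relation.Binary.BagAndSetEquality using (∼bag⇒↭)
open import Function using (_∘_; id; _↔_; Inverse; mk⇔; mk↔ₛ′)
open import Algebra.Bundles using (CommutativeRing)
import Algebra.Solver.Ring.AlmostCommutativeRing as ACR
open import Relation.Binary.Definitions using (DecidableEquality; tri<; tri≈; tri>)
open import Relation.Nullary using (¬?; Dec; yes; no; contradiction)
open import Relation.Nullary.Decidable using (map′; _×-dec_)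
open import Relation.Unary using (Pred; Decidable; _≐_; _∩_; ∁)
open import Relation.Unary.Properties using (_∩?_; ∁?)
import Relation.Binary.PropositionalEquality as ≡

-- The ring solver normalises coefficients by evaluation, so they must come from a ring whose
-- equality computes; ℤ maps into every commutative ring.
module IntegerCoefficientSolver {c ℓ} (R : CommutativeRing c ℓ) where
  open CommutativeRing R
  open import Algebra.Properties.Ring ring
  open import Algebra.Properties.Semiring.Mult.TCOptimised semiring renaming (_×_ to _×ₙ_)
  open import Algebra.Properties.CommutativeSemigroup +-commutativeSemigroup using (interchange)
  open import Relation.Binary.Reasoning.Setoid setoid

  signed : Sign → Carrier → Carrier
  signed Sign.+ x = x
  signed Sign.- x = - x

  -- With the type-checking-optimised n-fold sum, fromℤ 1 and fromℤ 2 reduce to 1# and 1# + 1#.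
  fromℤ : ℤ → Carrier
  fromℤ i = signed (ℤ.sign i) (ℤ.∣ i ∣ ×ₙ 1#)

  signed-cong : ∀ s {x y} → x ≈ y → signed s x ≈ signed s y
  signed-cong Sign.+ x≈y = x≈y
  signed-cong Sign.- x≈y = -‿cong x≈y

  signed-* : ∀ s t x y → signed (s Sign.* t) (x * y) ≈ signed s x * signed t y
  signed-* Sign.+ Sign.+ x y = refl
  signed-* Sign.+ Sign.- x y = -‿distribʳ-* x y
  signed-* Sign.- Sign.+ x y = -‿distribˡ-* x y
  signed-* Sign.- Sign.- x y = begin
    x * y         ≈⟨ -‿involutive (x * y) ⟨
    - - (x * y)   ≈⟨ -‿cong (-‿distribˡ-* x y) ⟩
    - (- x * y)   ≈⟨ -‿distribʳ-* (- x) y ⟩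
    - x * - y     ∎

  fromℤ-◃ : ∀ s n → fromℤ (s ℤ.◃ n) ≈ signed s (n ×ₙ 1#)
  fromℤ-◃ Sign.+ zero    = refl
  fromℤ-◃ Sign.- zero    = sym -0#≈0#
  fromℤ-◃ Sign.+ (suc n) = refl
  fromℤ-◃ Sign.- (suc n) = refl

  fromℤ-⊖ : ∀ m n → fromℤ (m ℤ.⊖ n) ≈ m ×ₙ 1# - n ×ₙ 1#
  fromℤ-⊖ m       zero    = sym (trans (+-congˡ -0#≈0#) (+-identityʳ _))
  fromℤ-⊖ zero    (suc n) = sym (+-identityˡ _)
  fromℤ-⊖ (suc m) (suc n) = begin
    fromℤ (suc m ℤ.⊖ suc n)            ≡⟨ ≡.cong fromℤ (ℤ.[1+m]⊖[1+n]≡m⊖n m n) ⟩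
    fromℤ (m ℤ.⊖ n)                    ≈⟨ fromℤ-⊖ m n ⟩
    m ×ₙ 1# - n ×ₙ 1#                  ≈⟨ +-identityˡ _ ⟨
    0# + (m ×ₙ 1# - n ×ₙ 1#)           ≈⟨ +-congʳ (-‿inverseʳ 1#) ⟨
    (1# - 1#) + (m ×ₙ 1# - n ×ₙ 1#)    ≈⟨ interchange 1# (- 1#) (m ×ₙ 1#) (- (n ×ₙ 1#)) ⟩
    (1# + m ×ₙ 1#) + (- 1# - n ×ₙ 1#)  ≈⟨ +-congˡ (-‿+-comm 1# (n ×ₙ 1#)) ⟩
    (1# + m ×ₙ 1#) - (1# + n ×ₙ 1#)    ≈⟨ +-cong (×-homo-+ 1# 1 m) (-‿cong (×-homo-+ 1# 1 n)) ⟨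
    suc m ×ₙ 1# - suc n ×ₙ 1#          ∎

  fromℤ-+ : ∀ i j → fromℤ (i ℤ.+ j) ≈ fromℤ i + fromℤ j
  fromℤ-+ (+ m)    (+ n)    = ×-homo-+ 1# m n
  fromℤ-+ (+ m)    -[1+ n ] = fromℤ-⊖ m (suc n)
  fromℤ-+ -[1+ m ] (+ n)    = trans (fromℤ-⊖ n (suc m)) (+-comm _ _)
  fromℤ-+ -[1+ m ] -[1+ n ] = begin
    - (suc (suc (m ℕ.+ n)) ×ₙ 1#)     ≡⟨ ≡.cong (λ k → - (suc k ×ₙ 1#)) (ℕ.+-suc m n) ⟨
    - ((suc m ℕ.+ suc n) ×ₙ 1#)       ≈⟨ -‿cong (×-homo-+ 1# (suc m) (suc n)) ⟩
    - (suc m ×ₙ 1# + suc n ×ₙ 1#)     ≈⟨ -‿+-comm _ _ ⟨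
    - (suc m ×ₙ 1#) + - (suc n ×ₙ 1#) ∎

  fromℤ-* : ∀ i j → fromℤ (i ℤ.* j) ≈ fromℤ i * fromℤ j
  fromℤ-* i j = begin
    fromℤ (s ℤ.◃ m ℕ.* n)             ≈⟨ fromℤ-◃ s (m ℕ.* n) ⟩
    signed s ((m ℕ.* n) ×ₙ 1#)        ≈⟨ signed-cong s (×1-homo-* m n) ⟩
    signed s ((m ×ₙ 1#) * (n ×ₙ 1#))  ≈⟨ signed-* (ℤ.sign i) (ℤ.sign j) _ _ ⟩
    fromℤ i * fromℤ j                 ∎
    where
    s = ℤ.sign i Sign.* ℤ.sign j
    m = ℤ.∣ i ∣
    n = ℤ.∣ j ∣

  fromℤ-neg : ∀ i → fromℤ (ℤ.- i) ≈ - fromℤ i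
  fromℤ-neg (+ zero)  = sym -0#≈0#
  fromℤ-neg (+ suc n) = refl
  fromℤ-neg -[1+ n ]  = sym (-‿involutive _)

  fromℤ-homomorphism : ℤ.+-*-rawRing ACR.-Raw-AlmostCommutative⟶ ACR.fromCommutativeRing R
  fromℤ-homomorphism = record
    { ⟦_⟧    = fromℤ
    ; +-homo = fromℤ-+
    ; *-homo = fromℤ-*
    ; -‿homo = fromℤ-neg
    ; 0-homo = refl
    ; 1-homo = refl
    }

  fromℤ-≟ : ∀ i j → Maybe (fromℤ i ≈ fromℤ j)
  fromℤ-≟ i j with i ℤ.≟ j
  ... | yes i≡j = just (reflexive (≡.cong fromℤ i≡j))
  ... | no _    = nothing

  open import Algebra.Solver.Ring ℤ.+-*-rawRing (ACR.fromCommutativeRing R) fromℤ-homomorphism fromℤ-≟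
    public using (solve; _:=_; _:+_; _:*_; _:-_; :-_; con)

module Counting where

  open ≡ using (refl; sym; trans; cong; cong₂; subst; module ≡-Reasoning)
  open import Data.Nat using (_+_; _*_)
  open import Algebra.Properties.CommutativeSemigroup ℕ.+-commutativeSemigroup
    using () renaming (interchange to +-interchange)

  private
    variable
      A B : Set

  indicator : ∀ {P : Set} → Dec P → ℕ
  indicator (yes _) = 1
  indicator (no _)  = 0

  indicator-× : ∀ {P Q : Set} (p : Dec P) (q : Dec Q) → indicator (p ×-dec q) ≡ indicator p * indicator q
  indicator-× (yes _) (yes _) = refl
  indicator-× (yes _) (no _)  = refl
  indicator-× (no _)  _       = refl

  indicator-cong : ∀ {P Q : Set} (p : Dec P) (q : Dec Q) → (P → Q) → (Q → P) → indicator p ≡ indicator q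
  indicator-cong (yes _) (yes _) _   _   = refl
  indicator-cong (yes p) (no ¬q) p→q _   = contradiction (p→q p) ¬q
  indicator-cong (no ¬p) (yes q) _   q→p = contradiction (q→p q) ¬p
  indicator-cong (no _)  (no _)  _   _   = refl

  indicator-¬ : ∀ {P : Set} (p : Dec P) → indicator p + indicator (¬? p) ≡ 1
  indicator-¬ (yes _) = refl
  indicator-¬ (no _)  = refl

  sumBy : (A → ℕ) → List A → ℕ
  sumBy f xs = sum (map f xs)

  sumBy-cong : ∀ {f g : A → ℕ} → (∀ x → f x ≡ g x) → ∀ xs → sumBy f xs ≡ sumBy g xs
  sumBy-cong f≗g xs = cong sum (map-cong f≗g xs)

  sumBy-+ : ∀ (f g : A → ℕ) xs → sumBy (λ x → f x + g x) xs ≡ sumBy f xs + sumBy g xs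
  sumBy-+ f g []       = refl
  sumBy-+ f g (x ∷ xs) = begin
    (f x + g x) + sumBy (λ x → f x + g x) xs    ≡⟨ cong (λ z → (f x + g x) + z) (sumBy-+ f g xs) ⟩
    (f x + g x) + (sumBy f xs + sumBy g xs)     ≡⟨ +-interchange (f x) (g x) _ _ ⟩
    (f x + sumBy f xs) + (g x + sumBy g xs)     ∎
    where open ≡-Reasoning

  sumBy-*ˡ : ∀ n (f : A → ℕ) xs → sumBy (λ x → n * f x) xs ≡ n * sumBy f xs
  sumBy-*ˡ n f []       = sym (ℕ.*-zeroʳ n)
  sumBy-*ˡ n f (x ∷ xs) = trans (cong (λ z → n * f x + z) (sumBy-*ˡ n f xs)) (sym (ℕ.*-distribˡ-+ n (f x) _))

  sumBy-const : ∀ n (xs : List A) → sumBy (λ _ → n) xs ≡ n * length xs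
  sumBy-const n []       = sym (ℕ.*-zeroʳ n)
  sumBy-const n (x ∷ xs) = trans (cong (λ z → n + z) (sumBy-const n xs)) (sym (ℕ.*-suc n (length xs)))

  sumBy-↭ : ∀ (f : A → ℕ) {xs ys} → xs ↭ ys → sumBy f xs ≡ sumBy f ys
  sumBy-↭ f xs↭ys = sum-↭ (↭.map⁺ f xs↭ys)

  length-filter : ∀ {P : Pred A _} (P? : Decidable P) xs → length (filter P? xs) ≡ sumBy (indicator ∘ P?) xs
  length-filter P? []       = refl
  length-filter P? (x ∷ xs) with P? x
  ... | yes _ = cong suc (length-filter P? xs)
  ... | no _  = length-filter P? xs

  unique∧set⇒↭ : ∀ {xs ys : List A} → Unique xs → Unique ys →
                 (∀ {x} → x ∈ xs → x ∈ ys) → (∀ {x} → x ∈ ys → x ∈ xs) → xs ↭ ys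
  unique∧set⇒↭ !xs !ys xs⊆ys ys⊆xs = ∼bag⇒↭ (unique∧set⇒bag !xs !ys (mk⇔ xs⊆ys ys⊆xs))

  sumBy-map : ∀ (f : B → ℕ) (g : A → B) xs → sumBy f (map g xs) ≡ sumBy (f ∘ g) xs
  sumBy-map f g xs = cong sum (sym (map-∘ xs))

  sumBy-swap : ∀ (f : A → B → ℕ) xs ys →
               sumBy (λ x → sumBy (f x) ys) xs ≡ sumBy (λ y → sumBy (λ x → f x y) xs) ys
  sumBy-swap f []       ys = sym (trans (sumBy-const 0 ys) (ℕ.*-zeroˡ (length ys)))
  sumBy-swap f (x ∷ xs) ys = trans (cong (λ z → sumBy (f x) ys + z) (sumBy-swap f xs ys)) (sym (sumBy-+ (f x) _ ys))

  sumBy-cartesianProduct : ∀ (f : A × B → ℕ) xs ys →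
    sumBy f (cartesianProduct xs ys) ≡ sumBy (λ x → sumBy (λ y → f (x , y)) ys) xs
  sumBy-cartesianProduct f []       ys = refl
  sumBy-cartesianProduct f (x ∷ xs) ys = begin
    sumBy f (map (x ,_) ys ++ cartesianProduct xs ys)
      ≡⟨ cong sum (map-++ f (map (x ,_) ys) _) ⟩
    sum (map f (map (x ,_) ys) ++ map f (cartesianProduct xs ys))
      ≡⟨ sum-++ (map f (map (x ,_) ys)) _ ⟩
    sumBy f (map (x ,_) ys) + sumBy f (cartesianProduct xs ys)
      ≡⟨ cong₂ _+_ (sumBy-map f (x ,_) ys) (sumBy-cartesianProduct f xs ys) ⟩
    sumBy (λ y → f (x , y)) ys + sumBy (λ x → sumBy (λ y → f (x , y)) ys) xs
      ∎
    where open ≡-Reasoning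

  module Enumeration {A : Set} (_≟_ : DecidableEquality A) {elements : List A}
                     (complete : ∀ x → x ∈ elements) (unique : Unique elements) where

    ∑ : (A → ℕ) → ℕ
    ∑ f = sumBy f elements

    count : {P : Pred A 0ℓ} → Decidable P → ℕ
    count P? = ∑ (indicator ∘ P?)

    ∃? : {P : Pred A 0ℓ} → Decidable P → Dec (∃ P)
    ∃? P? = map′ satisfied (λ (x , px) → lose (complete x) px) (any? P? elements)

    ∑-permute : (π : A ↔ A) (f : A → ℕ) → ∑ (f ∘ Inverse.to π) ≡ ∑ f
    ∑-permute π f = trans (sym (sumBy-map f to elements)) (sumBy-↭ f image↭elements)
      where
      open Inverse π
      to-injective : ∀ {x y} → to x ≡ to y → x ≡ y
      to-injective {x} {y} tx≡ty = trans (sym (strictlyInverseʳ x)) (trans (cong from tx≡ty) (strictlyInverseʳ y))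
      !image : Unique (map to elements)
      !image = Unique.map⁺ to-injective unique
      onto : ∀ {x} → x ∈ elements → x ∈ map to elements
      onto {x} _ = subst (_∈ map to elements) (strictlyInverseˡ x) (∈-map⁺ to (complete (from x)))
      image↭elements : map to elements ↭ elements
      image↭elements = unique∧set⇒↭ !image unique (λ _ → complete _) onto

    module _ {P : Pred A 0ℓ} (P? : Decidable P) where

      count-∘ : (π : A ↔ A) → count (P? ∘ Inverse.to π) ≡ count P?
      count-∘ π = ∑-permute π (indicator ∘ P?)

      count-cong : ∀ {Q : Pred A 0ℓ} (Q? : Decidable Q) → P ≐ Q → count P? ≡ count Q?
      count-cong Q? (P⊆Q , Q⊆P) = sumBy-cong (λ x → indicator-cong (P? x) (Q? x) P⊆Q Q⊆P) elements

      count-split : ∀ {Q : Pred A 0ℓ} (Q? : Decidable Q) → count P? ≡ count (P? ∩? Q?) + count (P? ∩? ∁? Q?)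
      count-split Q? = trans (sumBy-cong split elements) (sumBy-+ _ _ elements)
        where
        split : ∀ x → indicator (P? x) ≡ indicator ((P? ∩? Q?) x) + indicator ((P? ∩? ∁? Q?) x)
        split x with P? x | Q? x
        ... | yes _ | yes _ = refl
        ... | yes _ | no _  = refl
        ... | no _  | _     = refl

      count-∁ : count P? + count (∁? P?) ≡ length elements
      count-∁ = begin
        count P? + count (∁? P?)                          ≡⟨ sumBy-+ _ _ elements ⟨
        ∑ (λ x → indicator (P? x) + indicator (∁? P? x))  ≡⟨ sumBy-cong (indicator-¬ ∘ P?) elements ⟩
        ∑ (λ _ → 1)                                       ≡⟨ sumBy-const 1 elements ⟩
        1 * length elements                               ≡⟨ ℕ.*-identityˡ _ ⟩
        length elements                                   ∎
        where open ≡-Reasoning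

      count-exact : ∀ {xs} → Unique xs → P ≐ (_∈ xs) → count P? ≡ length xs
      count-exact !xs (P⊆xs , xs⊆P) = trans (sym (length-filter P? elements)) (↭.↭-length filtered↭xs)
        where
        filtered↭xs = unique∧set⇒↭ (Unique.filter⁺ P? unique) !xs
          (λ m → P⊆xs (proj₂ (∈-filter⁻ P? {xs = elements} m)))
          (λ m → ∈-filter⁺ P? (complete _) (xs⊆P m))

    count-≡ˡ : ∀ u → count (u ≟_) ≡ 1
    count-≡ˡ u = count-exact (u ≟_) ([] ∷ []) ((λ { refl → here refl }) , λ { (here refl) → refl })

    count-≡ʳ : ∀ u → count (_≟ u) ≡ 1
    count-≡ʳ u = count-exact (_≟ u) ([] ∷ []) ((λ { refl → here refl }) , λ { (here refl) → refl })

    count-all : count {P = λ _ → ⊤} (λ _ → yes tt) ≡ length elements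
    count-all = trans (sumBy-const 1 elements) (ℕ.*-identityˡ _)

    count-fibres : ∀ {P : Pred A 0ℓ} (P? : Decidable P) (g : A → A) →
                   count P? ≡ ∑ (λ y → count (P? ∩? (λ x → g x ≟ y)))
    count-fibres P? g =
      trans (sumBy-cong fibre elements) (sumBy-swap (λ x y → indicator (P? x ×-dec (g x ≟ y))) elements elements)
      where
      fibre : ∀ x → indicator (P? x) ≡ ∑ (λ y → indicator (P? x ×-dec (g x ≟ y)))
      fibre x = sym (begin
        ∑ (λ y → indicator (P? x ×-dec (g x ≟ y)))
          ≡⟨ sumBy-cong (indicator-× (P? x) ∘ (g x ≟_)) elements ⟩
        ∑ (λ y → indicator (P? x) * indicator (g x ≟ y))  ≡⟨ sumBy-*ˡ (indicator (P? x)) _ elements ⟩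
        indicator (P? x) * count (g x ≟_)                 ≡⟨ cong (indicator (P? x) *_) (count-≡ˡ (g x)) ⟩
        indicator (P? x) * 1                              ≡⟨ ℕ.*-identityʳ _ ⟩
        indicator (P? x)                                  ∎)
        where open ≡-Reasoning

    position : A → Fin (length elements)
    position x = Any.index (complete x)

    position-injective : ∀ {x y} → position x ≡ position y → x ≡ y
    position-injective {x} {y} eq =
      trans (lookup-index (complete x)) (trans (cong (lookup elements) eq) (sym (lookup-index (complete y))))

    -- The elements moved by σ split into those listed before their image and those listed after it,
    -- and σ exchanges the two classes.
    count-involution : ∀ {P : Pred A 0ℓ} (P? : Decidable P) (σ : A → A) → (∀ x → σ (σ x) ≡ x) →
                       (∀ {x} → P x → P (σ x)) →
                       ∃ λ k → count P? ≡ count (P? ∩? (λ x → σ x ≟ x)) + 2 * k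
    count-involution {P} P? σ σσ P-closed = k , (begin
        count P?                                   ≡⟨ count-split P? fixed? ⟩
        f + count moved?                           ≡⟨ cong (λ n → f + n) (count-split moved? before?) ⟩
        f + (k + count (moved? ∩? ∁? before?))     ≡⟨ cong (λ n → f + (k + n)) after≡σ-before ⟩
        f + (k + count ((moved? ∩? before?) ∘ σ))  ≡⟨ cong (λ n → f + (k + n)) σ-before≡before ⟩
        f + (k + k)                                ≡⟨ cong (λ n → f + (k + n)) (ℕ.+-identityʳ k) ⟨
        f + 2 * k                                  ∎)
      where
      open ≡-Reasoning
      Fixed Before : Pred A 0ℓ
      Fixed x = σ x ≡ x
      Before x = position x Fin.< position (σ x)
      fixed? : Decidable Fixed
      fixed? x = σ x ≟ x
      moved? : Decidable (P ∩ ∁ Fixed)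
      moved? = P? ∩? ∁? fixed?
      before? : Decidable Before
      before? x = position x Fin.<? position (σ x)
      f = count (P? ∩? fixed?)
      k = count (moved? ∩? before?)

      after⇒σ-before : ∀ {x} → ((P ∩ ∁ Fixed) ∩ ∁ Before) x → ((P ∩ ∁ Fixed) ∩ Before) (σ x)
      after⇒σ-before {x} ((px , ¬fx) , ¬bx) =
        (P-closed px , (λ fσx → ¬fx (sym (trans (sym (σσ x)) fσx)))) ,
        subst (λ y → position (σ x) Fin.< position y) (sym (σσ x)) σx<x
        where
        σx<x : position (σ x) Fin.< position x
        σx<x with Fin.<-cmp (position x) (position (σ x))
        ... | tri< x<σx _ _ = contradiction x<σx ¬bx
        ... | tri≈ _ x≈σx _ = contradiction (sym (position-injective x≈σx)) ¬fx
        ... | tri> _ _ σx<x = σx<x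

      σ-before⇒after : ∀ {x} → ((P ∩ ∁ Fixed) ∩ Before) (σ x) → ((P ∩ ∁ Fixed) ∩ ∁ Before) x
      σ-before⇒after {x} ((pσx , ¬fσx) , bσx) =
        (subst P (σσ x) (P-closed pσx) , (λ fx → ¬fσx (cong σ fx))) ,
        (λ bx → Fin.<-asym bx (subst (λ y → position (σ x) Fin.< position y) (σσ x) bσx))

      after≡σ-before : count (moved? ∩? ∁? before?) ≡ count ((moved? ∩? before?) ∘ σ)
      after≡σ-before =
        count-cong (moved? ∩? ∁? before?) ((moved? ∩? before?) ∘ σ) (after⇒σ-before , σ-before⇒after)

      σ-before≡before : count ((moved? ∩? before?) ∘ σ) ≡ k
      σ-before≡before = count-∘ (moved? ∩? before?) (mk↔ₛ′ σ σ σσ σσ)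

open Counting

module _ where
  open ≡ using (trans; cong; sym; module ≡-Reasoning)
  open import Data.Integer using (_+_; _-_; _*_)

  suc[m+n*k]≡k*q+q⇒m≡[q-1]+k*[q-n] : ∀ {m n k q} → suc (m ℕ.+ n ℕ.* k) ≡ k ℕ.* q ℕ.+ q →
                                      + m ≡ (+ q - 1ℤ) + + k * (+ q - + n)
  suc[m+n*k]≡k*q+q⇒m≡[q-1]+k*[q-n] {m} {n} {k} {q} eq = begin
    + m                                      ≡⟨ isolate (+ m) (+ n * + k) ⟩
    (1ℤ + (+ m + + n * + k)) - 1ℤ - + n * + k  ≡⟨ cong (λ z → z - 1ℤ - + n * + k) in-ℤ ⟩
    (+ k * + q + + q) - 1ℤ - + n * + k         ≡⟨ regroup (+ k) (+ q) (+ n) ⟩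
    (+ q - 1ℤ) + + k * (+ q - + n)             ∎
    where
    open ≡-Reasoning
    isolate : ∀ x y → x ≡ (1ℤ + (x + y)) - 1ℤ - y
    isolate = solve-∀
    regroup : ∀ k q n → (k * q + q) - 1ℤ - n * k ≡ (q - 1ℤ) + k * (q - n)
    regroup = solve-∀
    in-ℤ : 1ℤ + (+ m + + n * + k) ≡ + k * + q + + q
    in-ℤ = trans (cong (λ z → 1ℤ + (+ m + z)) (sym (ℤ.pos-* n k)))
                 (trans (cong +_ eq) (cong (_+ + q) (ℤ.pos-* k q)))

  [q-1]+u*[q-[1+x]]≡[q-1]+u*[q-1-y] : ∀ q {u x y} → u * x ≡ u * y →
                                      (q - 1ℤ) + u * (q - (1ℤ + x)) ≡ (q - 1ℤ) + u * (q - 1ℤ - y)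
  [q-1]+u*[q-[1+x]]≡[q-1]+u*[q-1-y] q {u} {x} {y} ux≡uy = begin
    (q - 1ℤ) + u * (q - (1ℤ + x))          ≡⟨ distribute q u x ⟩
    (q - 1ℤ) + (u * (q - 1ℤ) - u * x)      ≡⟨ cong (λ z → (q - 1ℤ) + (u * (q - 1ℤ) - z)) ux≡uy ⟩
    (q - 1ℤ) + (u * (q - 1ℤ) - u * y)      ≡⟨ distribute′ q u y ⟨
    (q - 1ℤ) + u * (q - 1ℤ - y)            ∎
    where
    open ≡-Reasoning
    distribute : ∀ q u x → (q - 1ℤ) + u * (q - (1ℤ + x)) ≡ (q - 1ℤ) + (u * (q - 1ℤ) - u * x)
    distribute = solve-∀
    distribute′ : ∀ q u y → (q - 1ℤ) + u * (q - 1ℤ - y) ≡ (q - 1ℤ) + (u * (q - 1ℤ) - u * y)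
    distribute′ = solve-∀

module FieldProperties (F : FiniteField) where
  open ≡ using (_≢_; refl; sym; trans; cong; cong₂; subst; module ≡-Reasoning)
  open FiniteField F public

  commutativeRing : CommutativeRing 0ℓ 0ℓ
  commutativeRing = record { isCommutativeRing = isCommutativeRing }

  open CommutativeRing commutativeRing public
    using (_-_; +-identityˡ; +-identityʳ; *-identityˡ; *-identityʳ; zeroˡ; zeroʳ; *-assoc; *-comm; -‿inverseʳ)
  open import Algebra.Properties.Ring (CommutativeRing.ring commutativeRing) public
    using (-‿involutive; -0#≈0#; x∙y⁻¹≈ε⇒x≈y; x≈y⇒x∙y⁻¹≈ε)
  open IntegerCoefficientSolver commutativeRing public
  open Enumeration _≟_ complete unique public

  two : Carrier
  two = 1# + 1#

  1≢0 : 1# ≢ 0#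
  1≢0 = 0≢1 ∘ sym

  infix 9 _⁻¹
  -- 0# ⁻¹ is the junk value 0#.
  _⁻¹ : Carrier → Carrier
  x ⁻¹ with x ≟ 0#
  ... | yes _   = 0#
  ... | no x≢0  = proj₁ (inverse x x≢0)

  ⁻¹-inverseʳ : ∀ {x} → x ≢ 0# → x * x ⁻¹ ≡ 1#
  ⁻¹-inverseʳ {x} x≢0 with x ≟ 0#
  ... | yes x≡0 = contradiction x≡0 x≢0
  ... | no x≢0′ = proj₂ (inverse x x≢0′)

  ⁻¹-inverseˡ : ∀ {x} → x ≢ 0# → x ⁻¹ * x ≡ 1#
  ⁻¹-inverseˡ x≢0 = trans (*-comm _ _) (⁻¹-inverseʳ x≢0)

  ⁻¹-cancelˡ : ∀ {a} x → a ≢ 0# → a ⁻¹ * (a * x) ≡ x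
  ⁻¹-cancelˡ {a} x a≢0 = begin
    a ⁻¹ * (a * x)   ≡⟨ *-assoc _ _ _ ⟨
    (a ⁻¹ * a) * x   ≡⟨ cong (_* x) (⁻¹-inverseˡ a≢0) ⟩
    1# * x           ≡⟨ *-identityˡ x ⟩
    x                ∎
    where open ≡-Reasoning

  *-cancelˡ : ∀ {a x y} → a ≢ 0# → a * x ≡ a * y → x ≡ y
  *-cancelˡ {a} {x} {y} a≢0 ax≡ay = begin
    x                ≡⟨ ⁻¹-cancelˡ x a≢0 ⟨
    a ⁻¹ * (a * x)   ≡⟨ cong (a ⁻¹ *_) ax≡ay ⟩
    a ⁻¹ * (a * y)   ≡⟨ ⁻¹-cancelˡ y a≢0 ⟩
    y                ∎
    where open ≡-Reasoning

  x*y≡0⇒x≡0∨y≡0 : ∀ {x y} → x * y ≡ 0# → x ≡ 0# ⊎ y ≡ 0#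
  x*y≡0⇒x≡0∨y≡0 {x} {y} xy≡0 with x ≟ 0#
  ... | yes x≡0 = inj₁ x≡0
  ... | no x≢0  = inj₂ (*-cancelˡ x≢0 (trans xy≡0 (sym (zeroʳ x))))

  x*y≢0 : ∀ {x y} → x ≢ 0# → y ≢ 0# → x * y ≢ 0#
  x*y≢0 x≢0 y≢0 = [ x≢0 , y≢0 ]′ ∘ x*y≡0⇒x≡0∨y≡0

  x*y≢0⇒x≢0 : ∀ {x y} → x * y ≢ 0# → x ≢ 0#
  x*y≢0⇒x≢0 {x} {y} xy≢0 x≡0 = xy≢0 (trans (cong (_* y) x≡0) (zeroˡ y))

  x*y≡1⇒x≢0 : ∀ {x y} → x * y ≡ 1# → x ≢ 0#
  x*y≡1⇒x≢0 xy≡1 = x*y≢0⇒x≢0 (λ xy≡0 → 1≢0 (trans (sym xy≡1) xy≡0))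

  ⁻¹-unique : ∀ {x y} → x * y ≡ 1# → x ⁻¹ ≡ y
  ⁻¹-unique xy≡1 = *-cancelˡ (x*y≡1⇒x≢0 xy≡1) (trans (⁻¹-inverseʳ (x*y≡1⇒x≢0 xy≡1)) (sym xy≡1))

  ⁻¹-≢0 : ∀ {x} → x ≢ 0# → x ⁻¹ ≢ 0#
  ⁻¹-≢0 x≢0 = x*y≡1⇒x≢0 (⁻¹-inverseˡ x≢0)

  0⁻¹≡0 : 0# ⁻¹ ≡ 0#
  0⁻¹≡0 with 0# ≟ 0#
  ... | yes _  = refl
  ... | no 0≢0 = contradiction refl 0≢0

  ⁻¹-involutive : ∀ x → x ⁻¹ ⁻¹ ≡ x
  ⁻¹-involutive x = by-cases (x ≟ 0#)
    where
    by-cases : Dec (x ≡ 0#) → x ⁻¹ ⁻¹ ≡ x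
    by-cases (yes refl) = trans (cong _⁻¹ 0⁻¹≡0) 0⁻¹≡0
    by-cases (no x≢0)   = ⁻¹-unique (⁻¹-inverseˡ x≢0)

  ⁻¹-distrib-* : ∀ {x y} → x ≢ 0# → y ≢ 0# → (x * y) ⁻¹ ≡ x ⁻¹ * y ⁻¹
  ⁻¹-distrib-* {x} {y} x≢0 y≢0 = ⁻¹-unique (begin
    (x * y) * (x ⁻¹ * y ⁻¹)
      ≡⟨ solve 4 (λ x y x′ y′ → (x :* y) :* (x′ :* y′) := (x :* x′) :* (y :* y′))
                 refl x y (x ⁻¹) (y ⁻¹) ⟩
    (x * x ⁻¹) * (y * y ⁻¹)       ≡⟨ cong₂ _*_ (⁻¹-inverseʳ x≢0) (⁻¹-inverseʳ y≢0) ⟩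
    1# * 1#                       ≡⟨ *-identityˡ 1# ⟩
    1#                            ∎)
    where open ≡-Reasoning

  x-y≡u-v⇒x≡y⇒u≡v : ∀ {x y u v} → x - y ≡ u - v → x ≡ y → u ≡ v
  x-y≡u-v⇒x≡y⇒u≡v x-y≡u-v x≡y =
    x∙y⁻¹≈ε⇒x≈y _ _ (trans (sym x-y≡u-v) (x≈y⇒x∙y⁻¹≈ε x≡y))

  x*x≡y*y⇒x≡±y : ∀ {x y} → x * x ≡ y * y → x ≡ y ⊎ x ≡ - y
  x*x≡y*y⇒x≡±y {x} {y} xx≡yy =
    Sum.map (x∙y⁻¹≈ε⇒x≈y x y) x+y≡0⇒x≡-y (x*y≡0⇒x≡0∨y≡0 difference-of-squares)
    where
    difference-of-squares : (x - y) * (x + y) ≡ 0#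
    difference-of-squares =
      trans (solve 2 (λ x y → (x :- y) :* (x :+ y) := x :* x :- y :* y) refl x y) (x≈y⇒x∙y⁻¹≈ε xx≡yy)
    x+y≡0⇒x≡-y : x + y ≡ 0# → x ≡ - y
    x+y≡0⇒x≡-y x+y≡0 = x∙y⁻¹≈ε⇒x≈y x (- y) (trans (cong (λ z → x + z) (-‿involutive y)) x+y≡0)

  ∑-affine : ∀ {α} β → α ≢ 0# → (f : Carrier → ℕ) → ∑ (λ y → f (α * y + β)) ≡ ∑ f
  ∑-affine {α} β α≢0 f = ∑-permute (mk↔ₛ′ affine affine⁻¹ inverseˡ inverseʳ) f
    where
    affine affine⁻¹ : Carrier → Carrier
    affine y = α * y + β
    affine⁻¹ w = α ⁻¹ * (w - β)
    inverseˡ : ∀ w → affine (affine⁻¹ w) ≡ w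
    inverseˡ w = begin
      α * (α ⁻¹ * (w - β)) + β
        ≡⟨ solve 4 (λ α α′ w β → α :* (α′ :* (w :- β)) :+ β := (α :* α′) :* (w :- β) :+ β)
                   refl α (α ⁻¹) w β ⟩
      (α * α ⁻¹) * (w - β) + β   ≡⟨ cong (λ u → u * (w - β) + β) (⁻¹-inverseʳ α≢0) ⟩
      1# * (w - β) + β           ≡⟨ solve 2 (λ w β → con 1ℤ :* (w :- β) :+ β := w) refl w β ⟩
      w                          ∎
      where open ≡-Reasoning
    inverseʳ : ∀ y → affine⁻¹ (affine y) ≡ y
    inverseʳ y =
      trans (cong (α ⁻¹ *_) (solve 3 (λ α y β → α :* y :+ β :- β := α :* y) refl α y β))
            (⁻¹-cancelˡ y α≢0)

  IsSquare : Pred Carrier 0ℓ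
  IsSquare t = ∃ λ y → y * y ≡ t

  isSquare? : Decidable IsSquare
  isSquare? t = ∃? (λ y → (y * y) ≟ t)

  sqrtCount : Carrier → ℕ
  sqrtCount t = count (λ y → (y * y) ≟ t)

  sqrtCount-nonsquare : ∀ {t} → ¬ IsSquare t → sqrtCount t ≡ 0
  sqrtCount-nonsquare ¬□t =
    count-exact (λ y → (y * y) ≟ _) [] ((λ {y} yy≡t → contradiction (y , yy≡t) ¬□t) , λ ())

  φ-0 : φ 0# ≡ 0ℤ
  φ-0 with 0# ≟ 0#
  ... | yes _  = refl
  ... | no 0≢0 = contradiction refl 0≢0

  φ-square : ∀ {t} → t ≢ 0# → IsSquare t → φ t ≡ 1ℤ
  φ-square {t} t≢0 (y , yy≡t) with t ≟ 0#
  ... | yes t≡0 = contradiction t≡0 t≢0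
  ... | no _ with any? (λ y → (y * y) ≟ t) elements
  ...   | yes _ = refl
  ...   | no ¬any = contradiction (lose (complete y) yy≡t) ¬any

  φ-nonsquare : ∀ {t} → t ≢ 0# → ¬ IsSquare t → φ t ≡ -1ℤ
  φ-nonsquare {t} t≢0 ¬□t with t ≟ 0#
  ... | yes t≡0 = contradiction t≡0 t≢0
  ... | no _ with any? (λ y → (y * y) ≟ t) elements
  ...   | yes any = contradiction (satisfied any) ¬□t
  ...   | no _    = refl

  isSquare-* : ∀ {t u} → IsSquare t → IsSquare u → IsSquare (t * u)
  isSquare-* (r , rr≡t) (s , ss≡u) =
    r * s , trans (solve 2 (λ r s → (r :* s) :* (r :* s) := (r :* r) :* (s :* s)) refl r s) (cong₂ _*_ rr≡t ss≡u)

  isSquare-⁻¹ : ∀ {u} → u ≢ 0# → IsSquare u → IsSquare (u ⁻¹)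
  isSquare-⁻¹ u≢0 (s , ss≡u) = s ⁻¹ , trans (sym (⁻¹-distrib-* s≢0 s≢0)) (cong _⁻¹ ss≡u)
    where s≢0 = x*y≢0⇒x≢0 (λ ss≡0 → u≢0 (trans (sym ss≡u) ss≡0))

  x*y*y⁻¹≡x : ∀ x {y} → y ≢ 0# → x * y * y ⁻¹ ≡ x
  x*y*y⁻¹≡x x {y} y≢0 = trans (*-assoc x y _) (trans (cong (x *_) (⁻¹-inverseʳ y≢0)) (*-identityʳ x))

  φ-*-square : ∀ t {u} → u ≢ 0# → IsSquare u → φ (t * u) ≡ φ t
  φ-*-square t {u} u≢0 □u = by-cases (t ≟ 0#) (isSquare? t)
    where
    by-cases : Dec (t ≡ 0#) → Dec (IsSquare t) → φ (t * u) ≡ φ t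
    by-cases (yes refl) _        = cong φ (zeroˡ u)
    by-cases (no t≢0)   (yes □t) =
      trans (φ-square (x*y≢0 t≢0 u≢0) (isSquare-* □t □u)) (sym (φ-square t≢0 □t))
    by-cases (no t≢0)   (no ¬□t) = trans (φ-nonsquare (x*y≢0 t≢0 u≢0) ¬□tu) (sym (φ-nonsquare t≢0 ¬□t))
      where
      ¬□tu : ¬ IsSquare (t * u)
      ¬□tu □tu = ¬□t (subst IsSquare (x*y*y⁻¹≡x t u≢0) (isSquare-* □tu (isSquare-⁻¹ u≢0 □u)))

  [1+φu]*φ[tu]≡[1+φu]*φt : ∀ t {u} → u ≢ 0# → (1ℤ ℤ.+ φ u) ℤ.* φ (t * u) ≡ (1ℤ ℤ.+ φ u) ℤ.* φ t
  [1+φu]*φ[tu]≡[1+φu]*φt t {u} u≢0 with isSquare? u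
  ... | yes □u  = cong ((1ℤ ℤ.+ φ u) ℤ.*_) (φ-*-square t u≢0 □u)
  ... | no ¬□u = trans (cong (λ i → (1ℤ ℤ.+ i) ℤ.* φ (t * u)) φu≡-1)
                       (sym (cong (λ i → (1ℤ ℤ.+ i) ℤ.* φ t) φu≡-1))
    where φu≡-1 = φ-nonsquare u≢0 ¬□u

  SquareOf : Pred Carrier 0ℓ → Pred Carrier 0ℓ
  SquareOf P y = ∃ λ x → P x × x * x ≡ y

  squareOf? : ∀ {P} → Decidable P → Decidable (SquareOf P)
  squareOf? P? y = ∃? (λ x → P? x ×-dec ((x * x) ≟ y))

  squareOf-≢0 : ∀ {P} → (∀ {x} → P x → x ≢ 0#) → ∀ {y} → SquareOf P y → y ≢ 0#
  squareOf-≢0 P⇒≢0 (x , px , refl) = x*y≢0 (P⇒≢0 px) (P⇒≢0 px)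

  squareOf-⁻¹ : ∀ {P} → (∀ {x} → P x → x ≢ 0#) → (∀ {x} → P x → P (x ⁻¹)) →
                ∀ {y} → SquareOf P y → SquareOf P (y ⁻¹)
  squareOf-⁻¹ P⇒≢0 P-inv (x , px , refl) = x ⁻¹ , P-inv px , sym (⁻¹-distrib-* (P⇒≢0 px) (P⇒≢0 px))

  x*x≡1⇒x≡±1 : ∀ {x} → x * x ≡ 1# → x ≡ 1# ⊎ x ≡ - 1#
  x*x≡1⇒x≡±1 xx≡1 = x*x≡y*y⇒x≡±y (trans xx≡1 (sym (*-identityˡ 1#)))

  1⁻¹≡1 : 1# ⁻¹ ≡ 1#
  1⁻¹≡1 = ⁻¹-unique (*-identityˡ 1#)

  -1⁻¹≡-1 : (- 1#) ⁻¹ ≡ - 1#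
  -1⁻¹≡-1 = ⁻¹-unique (solve 0 ((:- con 1ℤ) :* (:- con 1ℤ) := con 1ℤ) refl)

  module OddCharacteristic (2≢0 : two ≢ 0#) where

    x≢-x : ∀ {x} → x ≢ 0# → x ≢ - x
    x≢-x {x} x≢0 x≡-x =
      x*y≢0 2≢0 x≢0 (trans (solve 1 (λ x → con (ℤ.+ 2) :* x := x :- (:- x)) refl x) (x≈y⇒x∙y⁻¹≈ε x≡-x))

    ±-unique : ∀ {x} → x ≢ 0# → Unique (x ∷ - x ∷ [])
    ±-unique x≢0 = (x≢-x x≢0 ∷ []) ∷ [] ∷ []

    square-roots : ∀ {x} → x ≢ 0# → (λ y → y * y ≡ x * x) ≐ (_∈ x ∷ - x ∷ [])
    square-roots {x} x≢0 =
      (λ yy≡xx → [ here , there ∘ here ]′ (x*x≡y*y⇒x≡±y yy≡xx)) ,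
      λ { (here refl) → refl ; (there (here refl)) → solve 1 (λ x → (:- x) :* (:- x) := x :* x) refl x }

    sqrtCount-0 : sqrtCount 0# ≡ 1
    sqrtCount-0 = count-exact (λ y → (y * y) ≟ 0#) ([] ∷ [])
      ((λ yy≡0 → here ([ id , id ]′ (x*y≡0⇒x≡0∨y≡0 yy≡0))) , λ { (here refl) → zeroˡ 0# })

    sqrtCount-square : ∀ {t} → t ≢ 0# → IsSquare t → sqrtCount t ≡ 2
    sqrtCount-square t≢0 (s , refl) = count-exact (λ y → (y * y) ≟ (s * s)) (±-unique s≢0) (square-roots s≢0)
      where s≢0 = x*y≢0⇒x≢0 t≢0

    sqrtCount≡1+φ : ∀ t → ℤ.+ sqrtCount t ≡ 1ℤ ℤ.+ φ t
    sqrtCount≡1+φ t = by-cases (t ≟ 0#) (isSquare? t)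
      where
      values : ∀ {u n i} → sqrtCount u ≡ n → φ u ≡ i → ℤ.+ n ≡ 1ℤ ℤ.+ i →
               ℤ.+ sqrtCount u ≡ 1ℤ ℤ.+ φ u
      values refl refl n≡1+i = n≡1+i
      by-cases : Dec (t ≡ 0#) → Dec (IsSquare t) → ℤ.+ sqrtCount t ≡ 1ℤ ℤ.+ φ t
      by-cases (yes refl) _        = values sqrtCount-0 φ-0 refl
      by-cases (no t≢0)   (yes □t) = values (sqrtCount-square t≢0 □t) (φ-square t≢0 □t) refl
      by-cases (no t≢0)   (no ¬□t) = values (sqrtCount-nonsquare ¬□t) (φ-nonsquare t≢0 ¬□t) refl

    module _ {P : Pred Carrier 0ℓ} (P? : Decidable P) (P⇒≢0 : ∀ {x} → P x → x ≢ 0#) where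

      count-squareOf : (∀ {x} → P x → P (- x)) → count P? ≡ 2 ℕ.* count (squareOf? P?)
      count-squareOf P-neg =
        trans (count-fibres P? (λ x → x * x)) (trans (sumBy-cong fibre elements) (sumBy-*ˡ 2 _ elements))
        where
        fibre : ∀ y → count (P? ∩? (λ x → (x * x) ≟ y)) ≡ 2 ℕ.* indicator (squareOf? P? y)
        fibre y with squareOf? P? y
        ... | no ¬□y = count-exact (P? ∩? (λ x → (x * x) ≟ y)) []
                         ((λ (px , xx≡y) → contradiction (_ , px , xx≡y) ¬□y) , λ ())
        ... | yes (x₀ , px₀ , refl) =
          trans (count-cong (P? ∩? (λ x → (x * x) ≟ (x₀ * x₀))) (λ x → (x * x) ≟ (x₀ * x₀))
                            (proj₂ , λ xx≡ → root-in-P xx≡ , xx≡))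
                (sqrtCount-square (x*y≢0 (P⇒≢0 px₀) (P⇒≢0 px₀)) (x₀ , refl))
          where
          root-in-P : ∀ {x} → x * x ≡ x₀ * x₀ → P x
          root-in-P xx≡ = [ (λ { refl → px₀ }) , (λ { refl → P-neg px₀ }) ]′ (x*x≡y*y⇒x≡±y xx≡)

      count-inversion : (∀ {x} → P x → P (x ⁻¹)) → P 1# →
                        ∃ λ k → count P? ≡ suc (indicator (P? (- 1#))) ℕ.+ 2 ℕ.* k
      count-inversion P-inv P1 = let (k , count≡) = count-involution P? _⁻¹ ⁻¹-involutive P-inv in
        k , trans count≡ (cong (ℕ._+ 2 ℕ.* k) (fixed-points (P? (- 1#))))
        where
        fixed⇒±1 : ∀ {x} → (P ∩ (λ x → x ⁻¹ ≡ x)) x → x ≡ 1# ⊎ x ≡ - 1#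
        fixed⇒±1 {x} (px , x⁻¹≡x) =
          x*x≡1⇒x≡±1 (trans (cong (x *_) (sym x⁻¹≡x)) (⁻¹-inverseʳ (P⇒≢0 px)))
        fixed-points : (p : Dec (P (- 1#))) → count (P? ∩? (λ x → (x ⁻¹) ≟ x)) ≡ suc (indicator p)
        fixed-points (yes p-1) = count-exact (P? ∩? (λ x → (x ⁻¹) ≟ x)) (±-unique 1≢0)
          ((λ fx → [ here , there ∘ here ]′ (fixed⇒±1 fx)) ,
           λ { (here refl) → P1 , 1⁻¹≡1 ; (there (here refl)) → p-1 , -1⁻¹≡-1 })
        fixed-points (no ¬p-1) = count-exact (P? ∩? (λ x → (x ⁻¹) ≟ x)) ([] ∷ [])
          ((λ fx → [ here , (λ { refl → contradiction (proj₁ fx) ¬p-1 }) ]′ (fixed⇒±1 fx)) ,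
           λ { (here refl) → P1 , 1⁻¹≡1 })

  odd-card⇒2≢0 : ∀ {n} → card ≡ suc (2 ℕ.* n) → two ≢ 0#
  odd-card⇒2≢0 {n} card≡1+2n 2≡0 = ℕ.even≢odd k n (begin
      2 ℕ.* k                                           ≡⟨ cong (ℕ._+ 2 ℕ.* k) no-fixed-points ⟨
      count (all? ∩? (λ x → (x + 1#) ≟ x)) ℕ.+ 2 ℕ.* k  ≡⟨ proj₂ shift-parity ⟨
      count all?                                        ≡⟨ count-all ⟩
      card                                              ≡⟨ card≡1+2n ⟩
      suc (2 ℕ.* n)                                     ∎)
    where
    open ≡-Reasoning
    all? : Decidable {A = Carrier} (λ _ → ⊤)
    all? _ = yes tt
    -- In characteristic 2, translation by 1 is a fixed-point-free involution.
    shift-involutive : ∀ x → (x + 1#) + 1# ≡ x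
    shift-involutive x = begin
      (x + 1#) + 1#  ≡⟨ solve 1 (λ x → (x :+ con 1ℤ) :+ con 1ℤ := x :+ con (ℤ.+ 2)) refl x ⟩
      x + two        ≡⟨ cong (λ z → x + z) 2≡0 ⟩
      x + 0#         ≡⟨ +-identityʳ x ⟩
      x              ∎
    no-fixed-points : count (all? ∩? (λ x → (x + 1#) ≟ x)) ≡ 0
    no-fixed-points = count-exact (all? ∩? (λ x → (x + 1#) ≟ x)) []
      ((λ {x} (_ , x+1≡x) → contradiction (x+1≡x⇒1≡0 x x+1≡x) 1≢0) , λ ())
      where
      x+1≡x⇒1≡0 : ∀ x → x + 1# ≡ x → 1# ≡ 0#
      x+1≡x⇒1≡0 x x+1≡x =
        trans (solve 1 (λ x → con 1ℤ := (x :+ con 1ℤ) :- x) refl x) (x≈y⇒x∙y⁻¹≈ε x+1≡x)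
    shift-parity = count-involution all? (_+ 1#) shift-involutive (λ _ → tt)
    k = proj₁ shift-parity

  count-≢0 : suc (count (λ x → ¬? (x ≟ 0#))) ≡ card
  count-≢0 = trans (cong (ℕ._+ count (λ x → ¬? (x ≟ 0#))) (sym (count-≡ʳ 0#))) (count-∁ (_≟ 0#))

  parity-forces : ∀ {Q : Set} (q : Dec Q) {n k} → 2 ℕ.* n ≡ suc (indicator q) ℕ.+ 2 ℕ.* k → Q
  parity-forces (yes q) _  = q
  parity-forces (no _)  {n} {k} eq = contradiction eq (ℕ.even≢odd n k)

  parity-excludes : ∀ {Q : Set} (q : Dec Q) {n k} → suc (2 ℕ.* n) ≡ suc (indicator q) ℕ.+ 2 ℕ.* k → ¬ Q
  parity-excludes (yes _) {n} {k} eq _ = ℕ.even≢odd n k (ℕ.suc-injective eq)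
  parity-excludes (no ¬q) _ = ¬q

  module OneModFour (m : ℕ) (card≡1+4m : card ≡ suc (4 ℕ.* m)) where

    2≢0 : two ≢ 0#
    2≢0 = odd-card⇒2≢0 {2 ℕ.* m} (trans card≡1+4m (cong suc (ℕ.*-assoc 2 2 m)))

    open OddCharacteristic 2≢0 public

    Unit Square FourthPower : Pred Carrier 0ℓ
    Unit x = x ≢ 0#
    Square = SquareOf Unit
    FourthPower = SquareOf Square

    unit? : Decidable Unit
    unit? x = ¬? (x ≟ 0#)
    square? : Decidable Square
    square? = squareOf? unit?
    fourthPower? : Decidable FourthPower
    fourthPower? = squareOf? square?

    unit-neg : ∀ {x} → Unit x → Unit (- x)
    unit-neg x≢0 -x≡0 = x≢0 (trans (sym (-‿involutive _)) (trans (cong -_ -x≡0) -0#≈0#))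

    square⇒≢0 : ∀ {y} → Square y → y ≢ 0#
    square⇒≢0 = squareOf-≢0 id

    square-⁻¹ : ∀ {y} → Square y → Square (y ⁻¹)
    square-⁻¹ = squareOf-⁻¹ id ⁻¹-≢0

    square-1 : Square 1#
    square-1 = 1# , 1≢0 , *-identityˡ 1#

    count-square : count square? ≡ 2 ℕ.* m
    count-square = ℕ.*-cancelˡ-≡ _ _ 2 (begin
      2 ℕ.* count square?    ≡⟨ count-squareOf unit? id unit-neg ⟨
      count unit?            ≡⟨ ℕ.suc-injective (trans count-≢0 card≡1+4m) ⟩
      4 ℕ.* m                ≡⟨ ℕ.*-assoc 2 2 m ⟩
      2 ℕ.* (2 ℕ.* m)        ∎)
      where open ≡-Reasoning

    -1-square : Square (- 1#)
    -1-square = let (k , count≡) = count-inversion square? square⇒≢0 square-⁻¹ square-1 in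
      parity-forces (square? (- 1#)) {m} {k} (trans (sym count-square) count≡)

    i : Carrier
    i = proj₁ -1-square

    i≢0 : i ≢ 0#
    i≢0 = proj₁ (proj₂ -1-square)

    i*i≡-1 : i * i ≡ - 1#
    i*i≡-1 = proj₂ (proj₂ -1-square)

    square-neg : ∀ {y} → Square y → Square (- y)
    square-neg (x , x≢0 , refl) = i * x , x*y≢0 i≢0 x≢0 , (begin
      (i * x) * (i * x)   ≡⟨ solve 2 (λ i x → (i :* x) :* (i :* x) := (i :* i) :* (x :* x)) refl i x ⟩
      (i * i) * (x * x)   ≡⟨ cong (_* (x * x)) i*i≡-1 ⟩
      - 1# * (x * x)      ≡⟨ solve 1 (λ y → (:- con 1ℤ) :* y := :- y) refl (x * x) ⟩
      - (x * x)           ∎)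
      where open ≡-Reasoning

    count-fourthPower : count fourthPower? ≡ m
    count-fourthPower = ℕ.*-cancelˡ-≡ _ _ 2 (trans (sym (count-squareOf square? square⇒≢0 square-neg)) count-square)

    fourthPower-parity : ∃ λ k → m ≡ suc (indicator (fourthPower? (- 1#))) ℕ.+ 2 ℕ.* k
    fourthPower-parity =
      let (k , count≡) = count-inversion fourthPower? (squareOf-≢0 square⇒≢0)
                                          (squareOf-⁻¹ square⇒≢0 square-⁻¹) (1# , square-1 , *-identityˡ 1#)
      in k , trans (sym count-fourthPower) count≡

    -- (1 + i)² = 2 i turns a square root of 2 into one of i; conversely (z + z⁻¹)² = 2 when z⁴ = -1.
    isSquare-2⇒fourthPower-1 : IsSquare two → FourthPower (- 1#)
    isSquare-2⇒fourthPower-1 (y , y*y≡2) = i , (z , z≢0 , z*z≡i) , i*i≡-1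
      where
      open ≡-Reasoning
      z = (1# + i) * y ⁻¹
      y≢0 = x*y≢0⇒x≢0 (λ yy≡0 → 2≢0 (trans (sym y*y≡2) yy≡0))
      z*z≡i : z * z ≡ i
      z*z≡i = begin
        ((1# + i) * y ⁻¹) * ((1# + i) * y ⁻¹)
          ≡⟨ solve 3 (λ i y′ y → ((con 1ℤ :+ i) :* y′) :* ((con 1ℤ :+ i) :* y′)
                                 := (i :* con (ℤ.+ 2) :+ (con 1ℤ :+ i :* i)) :* (y′ :* y′)) refl i (y ⁻¹) y ⟩
        (i * two + (1# + i * i)) * (y ⁻¹ * y ⁻¹)
          ≡⟨ cong₂ (λ u v → (i * two + (1# + u)) * v) i*i≡-1 (sym (⁻¹-distrib-* y≢0 y≢0)) ⟩
        (i * two + (1# - 1#)) * (y * y) ⁻¹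
          ≡⟨ cong₂ (λ u v → (i * two + u) * v ⁻¹) (-‿inverseʳ 1#) y*y≡2 ⟩
        (i * two + 0#) * two ⁻¹
          ≡⟨ cong (_* two ⁻¹) (+-identityʳ _) ⟩
        i * two * two ⁻¹
          ≡⟨ x*y*y⁻¹≡x i 2≢0 ⟩
        i ∎
      z≢0 = x*y≢0⇒x≢0 (λ zz≡0 → i≢0 (trans (sym z*z≡i) zz≡0))

    fourthPower-1⇒isSquare-2 : FourthPower (- 1#) → IsSquare two
    fourthPower-1⇒isSquare-2 (x , (z , z≢0 , refl) , x*x≡-1) = z + z ⁻¹ , (begin
        (z + z ⁻¹) * (z + z ⁻¹)
          ≡⟨ solve 2 (λ z z′ → (z :+ z′) :* (z :+ z′) := z :* z :+ con (ℤ.+ 2) :* (z :* z′) :+ z′ :* z′)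
                     refl z (z ⁻¹) ⟩
        z * z + two * (z * z ⁻¹) + z ⁻¹ * z ⁻¹
          ≡⟨ cong₂ (λ u v → z * z + two * u + v) (⁻¹-inverseʳ z≢0) (sym (⁻¹-distrib-* z≢0 z≢0)) ⟩
        z * z + two * 1# + (z * z) ⁻¹
          ≡⟨ cong (λ v → z * z + two * 1# + v) (⁻¹-unique x*-x≡1) ⟩
        z * z + two * 1# - z * z
          ≡⟨ solve 2 (λ x t → x :+ t :* con 1ℤ :- x := t) refl (z * z) two ⟩
        two ∎)
      where
      open ≡-Reasoning
      x*-x≡1 : (z * z) * - (z * z) ≡ 1#
      x*-x≡1 = trans (solve 1 (λ x → x :* (:- x) := :- (x :* x)) refl (z * z))
                     (trans (cong -_ x*x≡-1) (-‿involutive 1#))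

  card%4≡1⇒2≢0 : card % 4 ≡ 1 → two ≢ 0#
  card%4≡1⇒2≢0 card%4≡1 =
    OneModFour.2≢0 (card / 4) (trans (ℕ.m≡m%n+[m/n]*n card 4) (cong₂ ℕ._+_ card%4≡1 (ℕ.*-comm (card / 4) 4)))

  card%8≡1⇒φ2≡1 : card % 8 ≡ 1 → φ two ≡ 1ℤ
  card%8≡1⇒φ2≡1 card%8≡1 =
    φ-square 2≢0 (fourthPower-1⇒isSquare-2 (parity-forces (fourthPower? (- 1#)) {j} {k} m≡1+[-1⁴]+2k))
    where
    j = card / 8
    card≡1+4[2j] : card ≡ suc (4 ℕ.* (2 ℕ.* j))
    card≡1+4[2j] = trans (ℕ.m≡m%n+[m/n]*n card 8)
                         (cong₂ ℕ._+_ card%8≡1 (trans (ℕ.*-comm j 8) (ℕ.*-assoc 4 2 j)))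
    open OneModFour (2 ℕ.* j) card≡1+4[2j]
    k = proj₁ fourthPower-parity
    m≡1+[-1⁴]+2k = proj₂ fourthPower-parity

  card%8≡5⇒φ2≡-1 : card % 8 ≡ 5 → φ two ≡ -1ℤ
  card%8≡5⇒φ2≡-1 card%8≡5 =
    φ-nonsquare 2≢0 (parity-excludes (fourthPower? (- 1#)) {j} {k} m≡1+[-1⁴]+2k ∘ isSquare-2⇒fourthPower-1)
    where
    j = card / 8
    card≡1+4[1+2j] : card ≡ suc (4 ℕ.* suc (2 ℕ.* j))
    card≡1+4[1+2j] = trans (ℕ.m≡m%n+[m/n]*n card 8)
                           (trans (cong₂ ℕ._+_ card%8≡5 (trans (ℕ.*-comm j 8) (ℕ.*-assoc 4 2 j)))
                                  (cong suc (sym (ℕ.*-suc 4 (2 ℕ.* j)))))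
    open OneModFour (suc (2 ℕ.* j)) card≡1+4[1+2j]
    k = proj₁ fourthPower-parity
    m≡1+[-1⁴]+2k = proj₂ fourthPower-parity

  module Curve (2≢0 : two ≢ 0#) {a b c d e f : Carrier}
               (a≢0 : a ≢ 0#) (b≢0 : b ≢ 0#) (d≢0 : d ≢ 0#) (e≢0 : e ≢ 0#)
               (af≡ce : a * f ≡ c * e) (c²≡4ab : c * c ≡ fromℕ 4 * (a * b)) (ab≡de : a * b ≡ d * e) where

    open OddCharacteristic 2≢0

    h : Carrier
    h = c * two ⁻¹

    c≡2h : c ≡ two * h
    c≡2h = sym (trans (solve 3 (λ t c t′ → t :* (c :* t′) := c :* (t :* t′)) refl two c (two ⁻¹))
                      (trans (cong (c *_) (⁻¹-inverseʳ 2≢0)) (*-identityʳ c)))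

    h*h≡ab : h * h ≡ a * b
    h*h≡ab = *-cancelˡ (x*y≢0 2≢0 2≢0) (begin
      (two * two) * (h * h)   ≡⟨ solve 2 (λ t h → (t :* t) :* (h :* h) := (t :* h) :* (t :* h)) refl two h ⟩
      (two * h) * (two * h)   ≡⟨ cong (λ u → u * u) c≡2h ⟨
      c * c                   ≡⟨ c²≡4ab ⟩
      fromℕ 4 * (a * b)       ≡⟨ cong (_* (a * b)) 4≡2*2 ⟩
      (two * two) * (a * b)   ∎)
      where
      open ≡-Reasoning
      4≡2*2 : fromℕ 4 ≡ two * two
      4≡2*2 = solve 0 (con 1ℤ :+ (con 1ℤ :+ (con 1ℤ :+ (con 1ℤ :+ con 0ℤ))) := con (ℤ.+ 2) :* con (ℤ.+ 2)) refl

    h*h≡de : h * h ≡ d * e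
    h*h≡de = trans h*h≡ab ab≡de

    h≢0 : h ≢ 0#
    h≢0 = x*y≢0⇒x≢0 (λ hh≡0 → x*y≢0 a≢0 b≢0 (trans (sym h*h≡ab) hh≡0))

    lhs rhs : Carrier → Carrier → Carrier
    lhs x y = a * (y * y) + b * (x * x) + c * (x * y)
    rhs x y = d + e * ((x * x) * (y * y)) + f * ((x * x * x) * y)

    A Δ : Carrier → Carrier
    A x = a - e * (x * x)
    Δ x = d * (a + e * (x * x))

    -- The difference of the two sides is a combination of ab - h², c - 2h, af - ce and de - h².
    factorisation : ∀ x y → a * a * (lhs x y - rhs x y) ≡ A x * ((a * y + h * x) * (a * y + h * x) - Δ x)
    factorisation x y = begin
        a * a * (lhs x y - rhs x y)
      ≡⟨ solve 9 (λ a b c d e f h x y →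
           a :* a :* ((a :* (y :* y) :+ b :* (x :* x) :+ c :* (x :* y))
                      :- (d :+ e :* ((x :* x) :* (y :* y)) :+ f :* ((x :* x :* x) :* y)))
           := (a :- e :* (x :* x)) :* ((a :* y :+ h :* x) :* (a :* y :+ h :* x) :- d :* (a :+ e :* (x :* x)))
              :+ (a :* (x :* x) :* (a :* b :- h :* h) :+ a :* (x :* y) :* (a :- e :* (x :* x)) :* (c :- con (ℤ.+ 2) :* h)
                  :- a :* (x :* x :* x :* y) :* (a :* f :- c :* e) :- e :* (x :* x :* (x :* x)) :* (d :* e :- h :* h)))
           refl a b c d e f h x y ⟩
        G + (a * (x * x) * (a * b - h * h) + a * (x * y) * A x * (c - two * h)
             - a * (x * x * x * y) * (a * f - c * e) - e * (x * x * (x * x)) * (d * e - h * h))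
      ≡⟨ cong (λ z → G + z) defects≡0 ⟩
        G + 0#
      ≡⟨ +-identityʳ G ⟩
        G
      ∎
      where
      open ≡-Reasoning
      G = A x * ((a * y + h * x) * (a * y + h * x) - Δ x)
      defects≡0 : a * (x * x) * (a * b - h * h) + a * (x * y) * A x * (c - two * h)
                  - a * (x * x * x * y) * (a * f - c * e) - e * (x * x * (x * x)) * (d * e - h * h) ≡ 0#
      defects≡0
        rewrite x≈y⇒x∙y⁻¹≈ε (sym h*h≡ab) | x≈y⇒x∙y⁻¹≈ε c≡2h
              | x≈y⇒x∙y⁻¹≈ε af≡ce       | x≈y⇒x∙y⁻¹≈ε (sym h*h≡de)
        = solve 4 (λ p q r s → p :* con 0ℤ :+ q :* con 0ℤ :- r :* con 0ℤ :- s :* con 0ℤ := con 0ℤ) refl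
            (a * (x * x)) (a * (x * y) * A x) (a * (x * x * x * y)) (e * (x * x * (x * x)))

    on-curve⇒ : ∀ {x y} → lhs x y ≡ rhs x y → A x * ((a * y + h * x) * (a * y + h * x) - Δ x) ≡ 0#
    on-curve⇒ {x} {y} l≡r =
      trans (sym (factorisation x y)) (trans (cong (a * a *_) (x≈y⇒x∙y⁻¹≈ε l≡r)) (zeroʳ _))

    on-curve⇐ : ∀ {x y} → A x * ((a * y + h * x) * (a * y + h * x) - Δ x) ≡ 0# → lhs x y ≡ rhs x y
    on-curve⇐ {x} {y} G≡0 =
      [ (λ aa≡0 → contradiction aa≡0 (x*y≢0 a≢0 a≢0)) , x∙y⁻¹≈ε⇒x≈y _ _ ]′
      (x*y≡0⇒x≡0∨y≡0 (trans (factorisation x y) G≡0))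

    Fibre : Carrier → Carrier → Set
    Fibre x w = A x * (w * w - Δ x) ≡ 0#

    fibre? : ∀ x → Decidable (Fibre x)
    fibre? x w = (A x * (w * w - Δ x)) ≟ 0#

    count-fibre : ∀ x → count (λ y → lhs x y ≟ rhs x y) ≡ count (fibre? x)
    count-fibre x =
      trans (count-cong (λ y → lhs x y ≟ rhs x y) (fibre? x ∘ λ y → a * y + h * x) (on-curve⇒ , on-curve⇐))
            (∑-affine (h * x) a≢0 (indicator ∘ fibre? x))

    count-fibre-degenerate : ∀ {x} → A x ≡ 0# → count (fibre? x) ≡ card
    count-fibre-degenerate {x} Ax≡0 = trans (count-cong (fibre? x) (λ _ → yes tt) ((λ _ → tt) , fibre-everywhere)) count-all
      where
      fibre-everywhere : ∀ {w} → ⊤ → Fibre x w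
      fibre-everywhere {w} _ = trans (cong (_* (w * w - Δ x)) Ax≡0) (zeroˡ _)

    count-fibre-regular : ∀ {x} → A x ≢ 0# → count (fibre? x) ≡ sqrtCount (Δ x)
    count-fibre-regular {x} Ax≢0 = count-cong (fibre? x) (λ w → (w * w) ≟ Δ x) (root , in-fibre)
      where
      root : ∀ {w} → Fibre x w → w * w ≡ Δ x
      root = [ (λ Ax≡0 → contradiction Ax≡0 Ax≢0) , x∙y⁻¹≈ε⇒x≈y _ _ ]′ ∘ x*y≡0⇒x≡0∨y≡0
      in-fibre : ∀ {w} → w * w ≡ Δ x → Fibre x w
      in-fibre ww≡Δ = trans (cong (A x *_) (x≈y⇒x∙y⁻¹≈ε ww≡Δ)) (zeroʳ _)

    Δ-degenerate : ∀ {x} → A x ≡ 0# → Δ x ≡ two * (a * d)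
    Δ-degenerate {x} Ax≡0 = begin
      d * (a + e * (x * x))  ≡⟨ cong (λ u → d * (a + u)) (sym (x∙y⁻¹≈ε⇒x≈y a _ Ax≡0)) ⟩
      d * (a + a)            ≡⟨ solve 2 (λ a d → d :* (a :+ a) := con (ℤ.+ 2) :* (a :* d)) refl a d ⟩
      two * (a * d)          ∎
      where open ≡-Reasoning

    S s : ℕ
    S = count (λ x → A x ≟ 0#)
    s = sqrtCount (two * (a * d))

    curveCount≡∑ : curveCount a b c d e f ≡ ∑ (λ x → count (λ y → lhs x y ≟ rhs x y))
    curveCount≡∑ =
      trans (length-filter _ (cartesianProduct elements elements)) (sumBy-cartesianProduct _ elements elements)

    -- The fibre over x has sqrtCount (Δ x) + [A x = 0]·(card - s) points; this is stated additively to avoid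
    -- truncated subtraction.
    fibre-balance : ∀ x → count (fibre? x) ℕ.+ s ℕ.* indicator (A x ≟ 0#) ≡
                        card ℕ.* indicator (A x ≟ 0#) ℕ.+ sqrtCount (Δ x)
    fibre-balance x with A x ≟ 0#
    ... | yes Ax≡0 = begin
      count (fibre? x) ℕ.+ s ℕ.* 1      ≡⟨ cong₂ ℕ._+_ (count-fibre-degenerate Ax≡0) (ℕ.*-identityʳ s) ⟩
      card ℕ.+ s
        ≡⟨ cong₂ ℕ._+_ (ℕ.*-identityʳ card) (cong sqrtCount (Δ-degenerate Ax≡0)) ⟨
      card ℕ.* 1 ℕ.+ sqrtCount (Δ x)  ∎
      where open ≡-Reasoning
    ... | no Ax≢0 = begin
      count (fibre? x) ℕ.+ s ℕ.* 0      ≡⟨ cong₂ ℕ._+_ (count-fibre-regular Ax≢0) (ℕ.*-zeroʳ s) ⟩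
      sqrtCount (Δ x) ℕ.+ 0           ≡⟨ ℕ.+-comm _ 0 ⟩
      sqrtCount (Δ x)                 ≡⟨ cong (ℕ._+ sqrtCount (Δ x)) (ℕ.*-zeroʳ card) ⟨
      card ℕ.* 0 ℕ.+ sqrtCount (Δ x)  ∎
      where open ≡-Reasoning

    curveCount-balance : curveCount a b c d e f ℕ.+ s ℕ.* S ≡ card ℕ.* S ℕ.+ ∑ (sqrtCount ∘ Δ)
    curveCount-balance = begin
      curveCount a b c d e f ℕ.+ s ℕ.* S
        ≡⟨ cong₂ ℕ._+_ (trans curveCount≡∑ (sumBy-cong count-fibre elements)) (sym (sumBy-*ˡ s _ elements)) ⟩
      ∑ (count ∘ fibre?) ℕ.+ ∑ (λ x → s ℕ.* indicator (A x ≟ 0#))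
        ≡⟨ sumBy-+ _ _ elements ⟨
      ∑ (λ x → count (fibre? x) ℕ.+ s ℕ.* indicator (A x ≟ 0#))
        ≡⟨ sumBy-cong fibre-balance elements ⟩
      ∑ (λ x → card ℕ.* indicator (A x ≟ 0#) ℕ.+ sqrtCount (Δ x))
        ≡⟨ sumBy-+ _ _ elements ⟩
      ∑ (λ x → card ℕ.* indicator (A x ≟ 0#)) ℕ.+ ∑ (sqrtCount ∘ Δ)
        ≡⟨ cong (ℕ._+ ∑ (sqrtCount ∘ Δ)) (sumBy-*ˡ card _ elements) ⟩
      card ℕ.* S ℕ.+ ∑ (sqrtCount ∘ Δ)
        ∎
      where open ≡-Reasoning

    -- Substituting w = v + h x turns w² = Δ x into the hyperbola v (v + 2 h x) = a d, which meets each
    -- line v = const ≠ 0 once and the line v = 0 not at all.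
    conic-identity : ∀ x v → (1# * v + h * x) * (1# * v + h * x) - Δ x ≡ v * (v + two * h * x) - a * d
    conic-identity x v = begin
      (1# * v + h * x) * (1# * v + h * x) - Δ x
        ≡⟨ solve 6 (λ v x h a d e → (con 1ℤ :* v :+ h :* x) :* (con 1ℤ :* v :+ h :* x) :- d :* (a :+ e :* (x :* x))
                                  := v :* (v :+ con (ℤ.+ 2) :* h :* x) :- a :* d :+ (x :* x) :* (h :* h :- d :* e))
                   refl v x h a d e ⟩
      v * (v + two * h * x) - a * d + (x * x) * (h * h - d * e)
        ≡⟨ cong (λ δ → v * (v + two * h * x) - a * d + (x * x) * δ) (x≈y⇒x∙y⁻¹≈ε h*h≡de) ⟩
      v * (v + two * h * x) - a * d + (x * x) * 0#
        ≡⟨ trans (cong (λ z → v * (v + two * h * x) - a * d + z) (zeroʳ (x * x))) (+-identityʳ _) ⟩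
      v * (v + two * h * x) - a * d
        ∎
      where open ≡-Reasoning

    sqrtCount-Δ : ∀ x → sqrtCount (Δ x) ≡ count (λ v → (v * (v + two * h * x)) ≟ (a * d))
    sqrtCount-Δ x = trans (sym (∑-affine (h * x) 1≢0 (indicator ∘ λ w → (w * w) ≟ Δ x)))
      (count-cong (λ v → ((1# * v + h * x) * (1# * v + h * x)) ≟ Δ x) (λ v → (v * (v + two * h * x)) ≟ (a * d))
        (x-y≡u-v⇒x≡y⇒u≡v (conic-identity x _) , x-y≡u-v⇒x≡y⇒u≡v (sym (conic-identity x _))))

    hyperbola-line : ∀ v → count (λ x → (v * (v + two * h * x)) ≟ (a * d)) ≡ indicator (¬? (v ≟ 0#))
    hyperbola-line v with v ≟ 0#
    ... | yes refl = count-exact (λ x → (0# * (0# + two * h * x)) ≟ (a * d)) []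
                       ((λ 0≡ad → contradiction (trans (sym 0≡ad) (zeroˡ _)) (x*y≢0 a≢0 d≢0)) , λ ())
    ... | no v≢0 = begin
      count (λ x → (v * (v + two * h * x)) ≟ (a * d))
        ≡⟨ sumBy-cong (λ x → cong (indicator ∘ (_≟ (a * d))) (linear x)) elements ⟩
      ∑ (λ x → indicator (((two * h * v) * x + v * v) ≟ (a * d)))
        ≡⟨ ∑-affine (v * v) (x*y≢0 (x*y≢0 2≢0 h≢0) v≢0) (indicator ∘ (_≟ (a * d))) ⟩
      count (_≟ (a * d))
        ≡⟨ count-≡ʳ (a * d) ⟩
      1 ∎
      where
      open ≡-Reasoning
      linear : ∀ x → v * (v + two * h * x) ≡ (two * h * v) * x + v * v
      linear x = solve 3 (λ v h x → v :* (v :+ con (ℤ.+ 2) :* h :* x) := (con (ℤ.+ 2) :* h :* v) :* x :+ v :* v)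
                         refl v h x

    conic-count : suc (∑ (sqrtCount ∘ Δ)) ≡ card
    conic-count = begin
      suc (∑ (sqrtCount ∘ Δ))
        ≡⟨ cong suc (sumBy-cong sqrtCount-Δ elements) ⟩
      suc (∑ (λ x → count (λ v → (v * (v + two * h * x)) ≟ (a * d))))
        ≡⟨ cong suc (sumBy-swap _ elements elements) ⟩
      suc (∑ (λ v → count (λ x → (v * (v + two * h * x)) ≟ (a * d))))
        ≡⟨ cong suc (sumBy-cong hyperbola-line elements) ⟩
      suc (count (λ v → ¬? (v ≟ 0#)))
        ≡⟨ count-≢0 ⟩
      card ∎
      where open ≡-Reasoning

    S≡sqrtCount : S ≡ sqrtCount (a * e ⁻¹)
    S≡sqrtCount = count-cong (λ x → A x ≟ 0#) (λ x → (x * x) ≟ (a * e ⁻¹)) (to , from)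
      where
      e*[a*e⁻¹]≡a : e * (a * e ⁻¹) ≡ a
      e*[a*e⁻¹]≡a = trans (solve 3 (λ e a e′ → e :* (a :* e′) := a :* (e :* e′)) refl e a (e ⁻¹))
                          (trans (cong (a *_) (⁻¹-inverseʳ e≢0)) (*-identityʳ a))
      to : ∀ {x} → A x ≡ 0# → x * x ≡ a * e ⁻¹
      to {x} Ax≡0 = *-cancelˡ e≢0 (trans (sym (x∙y⁻¹≈ε⇒x≈y a _ Ax≡0)) (sym e*[a*e⁻¹]≡a))
      from : ∀ {x} → x * x ≡ a * e ⁻¹ → A x ≡ 0#
      from xx≡ = x≈y⇒x∙y⁻¹≈ε (sym (trans (cong (e *_) xx≡) e*[a*e⁻¹]≡a))

    φ[a*e⁻¹]≡φ[a*d] : φ (a * e ⁻¹) ≡ φ (a * d)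
    φ[a*e⁻¹]≡φ[a*d] = trans (sym (φ-*-square (a * e ⁻¹) (x*y≢0 h≢0 h≢0) (h , refl))) (cong φ (begin
      a * e ⁻¹ * (h * h)     ≡⟨ cong (a * e ⁻¹ *_) h*h≡de ⟩
      a * e ⁻¹ * (d * e)     ≡⟨ solve 4 (λ a e′ d e → a :* e′ :* (d :* e) := a :* d :* e :* e′)
                                       refl a (e ⁻¹) d e ⟩
      a * d * e * e ⁻¹       ≡⟨ x*y*y⁻¹≡x (a * d) e≢0 ⟩
      a * d                  ∎))
      where open ≡-Reasoning

    curveCount-formula : ℤ.+ curveCount a b c d e f ≡
                         (ℤ.+ card ℤ.- 1ℤ) ℤ.+ (1ℤ ℤ.+ φ (a * d)) ℤ.* (ℤ.+ card ℤ.- 1ℤ ℤ.- φ two)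
    curveCount-formula = begin
      ℤ.+ N
        ≡⟨ suc[m+n*k]≡k*q+q⇒m≡[q-1]+k*[q-n] {N} {s} {S} {card} balance ⟩
      (q ℤ.- 1ℤ) ℤ.+ ℤ.+ S ℤ.* (q ℤ.- ℤ.+ s)
        ≡⟨ cong₂ (λ u v → (q ℤ.- 1ℤ) ℤ.+ u ℤ.* (q ℤ.- v)) S≡1+φ[ad] s≡1+φ[2ad] ⟩
      (q ℤ.- 1ℤ) ℤ.+ u ℤ.* (q ℤ.- (1ℤ ℤ.+ φ (two * (a * d))))
        ≡⟨ [q-1]+u*[q-[1+x]]≡[q-1]+u*[q-1-y] q {u} φ[2ad]≈φ[2] ⟩
      (q ℤ.- 1ℤ) ℤ.+ u ℤ.* (q ℤ.- 1ℤ ℤ.- φ two)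
        ∎
      where
      open ≡-Reasoning
      N = curveCount a b c d e f
      q = ℤ.+ card
      u = 1ℤ ℤ.+ φ (a * d)
      balance : suc (N ℕ.+ s ℕ.* S) ≡ S ℕ.* card ℕ.+ card
      balance = begin
        suc (N ℕ.+ s ℕ.* S)                       ≡⟨ cong suc curveCount-balance ⟩
        suc (card ℕ.* S ℕ.+ ∑ (sqrtCount ∘ Δ))    ≡⟨ ℕ.+-suc (card ℕ.* S) _ ⟨
        card ℕ.* S ℕ.+ suc (∑ (sqrtCount ∘ Δ))    ≡⟨ cong₂ ℕ._+_ (ℕ.*-comm card S) conic-count ⟩
        S ℕ.* card ℕ.+ card                       ∎
      S≡1+φ[ad] : ℤ.+ S ≡ u
      S≡1+φ[ad] =
        trans (cong ℤ.+_ S≡sqrtCount) (trans (sqrtCount≡1+φ _) (cong (λ i → 1ℤ ℤ.+ i) φ[a*e⁻¹]≡φ[a*d]))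
      s≡1+φ[2ad] : ℤ.+ s ≡ 1ℤ ℤ.+ φ (two * (a * d))
      s≡1+φ[2ad] = sqrtCount≡1+φ _
      φ[2ad]≈φ[2] : u ℤ.* φ (two * (a * d)) ≡ u ℤ.* φ two
      φ[2ad]≈φ[2] = [1+φu]*φ[tu]≡[1+φu]*φt two (x*y≢0 a≢0 d≢0)

corollary1p9 : (F : FiniteField) → let open FiniteField F in
    (p r q : ℕ) → Prime p → ¬ (p ≡ 2) → q ≡ p ^ r → card ≡ q → q % 4 ≡ 1 →
    (a b c d e f : Carrier) →
    ¬ (a ≡ 0#) → ¬ (b ≡ 0#) → ¬ (c ≡ 0#) → ¬ (d ≡ 0#) → ¬ (e ≡ 0#) → ¬ (f ≡ 0#) →
    a * f ≡ c * e → c * c ≡ fromℕ 4 * (a * b) → a * b ≡ d * e →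
    ((q % 8 ≡ 1 → + curveCount a b c d e f ≡ (+ 2 ℤ.* + q ℤ.- + 3) ℤ.+ (+ q ℤ.- + 2) ℤ.* φ (a * d))
     × (q % 8 ≡ 5 → + curveCount a b c d e f ≡ (+ 2 ℤ.* + q ℤ.- + 1) ℤ.+ + q ℤ.* φ (a * d)))
corollary1p9 F p r q _ _ _ ≡.refl q%4≡1 a b c d e f a≢0 b≢0 _ d≢0 e≢0 _ af≡ce c²≡4ab ab≡de =
    (λ q%8≡1 → ≡.trans (curveCount-φ2 (card%8≡1⇒φ2≡1 q%8≡1)) (evaluate-1mod8 (+ q) (φ (a * d))))
  , (λ q%8≡5 → ≡.trans (curveCount-φ2 (card%8≡5⇒φ2≡-1 q%8≡5)) (evaluate-5mod8 (+ q) (φ (a * d))))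
  where
  open FieldProperties F
  open Curve (card%4≡1⇒2≢0 q%4≡1) a≢0 b≢0 d≢0 e≢0 af≡ce c²≡4ab ab≡de
  curveCount-φ2 : ∀ {φ₂} → φ two ≡ φ₂ →
                    + curveCount a b c d e f ≡ (+ q ℤ.- 1ℤ) ℤ.+ (1ℤ ℤ.+ φ (a * d)) ℤ.* (+ q ℤ.- 1ℤ ℤ.- φ₂)
  curveCount-φ2 ≡.refl = curveCount-formula
  evaluate-1mod8 : ∀ q x → (q ℤ.- 1ℤ) ℤ.+ (1ℤ ℤ.+ x) ℤ.* (q ℤ.- 1ℤ ℤ.- 1ℤ) ≡
                           (+ 2 ℤ.* q ℤ.- + 3) ℤ.+ (q ℤ.- + 2) ℤ.* x
  evaluate-1mod8 = solve-∀
  evaluate-5mod8 : ∀ q x → (q ℤ.- 1ℤ) ℤ.+ (1ℤ ℤ.+ x) ℤ.* (q ℤ.- 1ℤ ℤ.- -1ℤ) ≡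
                           (+ 2 ℤ.* q ℤ.- + 1) ℤ.+ q ℤ.* x
  evaluate-5mod8 = solve-∀
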